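{- Let $\mathcal{J}$ be a small category and $M$ a model of the presheaf theory $\mathbb{T}^{\mathcal{J}}$. If $f,f':i\to j$ are parallel arrows in $\mathcal{J}$ and $\mathbb{T}^{\mathcal{J}}(M,\mathsf{x}_i)\vdash f(\mathsf{x}_i)=f'(\mathsf{x}_i)$, then $f=f'$.
   Context: The presheaf theory $\mathbb{T}^{\mathcal{J}}$ is the quasi-equational theory (partial Horn logic) with one sort $i$ for each object $i$ of $\mathcal{J}$ and one unary function symbol $f:i\to j$ for each arrow $f:i\to j$ of $\mathcal{J}$, with axioms $\top\vdash^{x:i}f(x)\downarrow$ (totality), $\top\vdash^{x:i}\mathsf{id}_i(x)=x$, and $\top\vdash^{x:i}g(f(x))=(g\circ f)(x)$ for composable $f,g$. Its models are exactly functors $\mathcal{J}\to\mathsf{Set}$ (its category of models is isomorphic to $\mathsf{Set}^{\mathcal{J}}$). For a model $M$, $\mathbb{T}^{\mathcal{J}}(M,\mathsf{x}_i)$ is the theory extending $\mathbb{T}^{\mathcal{J}}$ by a constant for each element of each $M(k)$ (declared defined) with axioms $\top\vdash \overline{M(f)(a)}=f(\overline a)$, together with a new constant $\mathsf{x}_i$ of sort $i$ and axiom $\top\vdash\mathsf{x}_i\downarrow$. -}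

module Defs where

open import Relation.Binary.PropositionalEquality using (_≡_)

record Category : Set₁ where
  infixr 9 _∘_
  field
    Obj  : Set
    Hom  : Obj → Obj → Set
    id   : (i : Obj) → Hom i i
    _∘_  : {i j k : Obj} → Hom j k → Hom i j → Hom i k
    idˡ  : {i j : Obj} (f : Hom i j) → id j ∘ f ≡ f
    idʳ  : {i j : Obj} (f : Hom i j) → f ∘ id i ≡ f
    assoc : {i j k l : Obj} (f : Hom i j) (g : Hom j k) (h : Hom k l) →
            (h ∘ g) ∘ f ≡ h ∘ (g ∘ f)

-- A model of the presheaf theory T^J: one set per sort, one total function
-- per function symbol, satisfying the identity and composition axioms.
record Model (J : Category) : Set₁ where
  open Category J
  field
    carrier : Obj → Set
    act     : {i j : Obj} → Hom i j → carrier i → carrier j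
    act-id  : {i : Obj} (a : carrier i) → act (id i) a ≡ a
    act-∘   : {i j k : Obj} (f : Hom i j) (g : Hom j k) (a : carrier i) →
              act g (act f a) ≡ act (g ∘ f) a

module Theory (J : Category) (M : Model J) (i : Category.Obj J) where
  open Category J
  open Model M

  data Term : Obj → Set where
    const : {k : Obj} → carrier k → Term k
    x     : Term i
    app   : {k l : Obj} → Hom k l → Term k → Term l

  -- Derivability of closed atomic formulas  ⊤ ⊢ t↓  and  ⊤ ⊢ t = s
  -- in partial Horn logic for the theory T^J(M, x_i): the least set of
  -- closed atoms containing all instances of the axioms (at defined terms)
  -- and closed under the logical rules of partial Horn logic
  -- (reflexivity on defined terms, symmetry, transitivity, strictness,
  -- substitution/congruence).
  infix 4 ⊢_↓ ⊢_≐_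
  data ⊢_↓ : {k : Obj} → Term k → Set
  data ⊢_≐_ : {k : Obj} → Term k → Term k → Set

  data ⊢_↓ where
    const↓  : {k : Obj} (a : carrier k) → ⊢ const a ↓
    x↓      : ⊢ x ↓
    total   : {k l : Obj} (f : Hom k l) {t : Term k} → ⊢ t ↓ → ⊢ app f t ↓
    strict-app : {k l : Obj} {f : Hom k l} {t : Term k} → ⊢ app f t ↓ → ⊢ t ↓
    strict-eq  : {k : Obj} {t s : Term k} → ⊢ t ≐ s → ⊢ t ↓
    subst↓  : {k : Obj} {t s : Term k} → ⊢ t ≐ s → ⊢ t ↓ → ⊢ s ↓

  data ⊢_≐_ where
    ax-id   : {k : Obj} {t : Term k} → ⊢ t ↓ → ⊢ app (id k) t ≐ t
    ax-∘    : {k l m : Obj} (f : Hom k l) (g : Hom l m) {t : Term k} →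
              ⊢ t ↓ → ⊢ app g (app f t) ≐ app (g ∘ f) t
    ax-diag : {k l : Obj} (f : Hom k l) (a : carrier k) →
              ⊢ const (act f a) ≐ app f (const a)
    refl≐   : {k : Obj} {t : Term k} → ⊢ t ↓ → ⊢ t ≐ t
    sym≐    : {k : Obj} {t s : Term k} → ⊢ t ≐ s → ⊢ s ≐ t
    trans≐  : {k : Obj} {t s u : Term k} → ⊢ t ≐ s → ⊢ s ≐ u → ⊢ t ≐ u
    cong≐   : {k l : Obj} (f : Hom k l) {t s : Term k} →
              ⊢ t ≐ s → ⊢ app f t ↓ → ⊢ app f t ≐ app f s

-- A model of T^J(M, x_i) is a presheaf N together with a natural map M → N
-- and an element of N(i) interpreting x_i, and derivable equations hold in
-- every such model. Take N = M + Hom(i, –), with x_i interpreted as id_i: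
-- there f(x_i) denotes the injected arrow f ∘ id_i = f, which the summand
-- M cannot confuse with anything, so f(x_i) = f′(x_i) forces f = f′.
module Submission where

open import Defs
open import Relation.Binary.PropositionalEquality
  using (_≡_; refl; sym; trans; cong; module ≡-Reasoning)
open import Data.Sum using (_⊎_; inj₁; inj₂)
open import Data.Sum.Properties using (inj₂-injective)

module _ {J : Category} where
  open Category J
  open Model

  representable : Obj → Model J
  representable i = record
    { carrier = Hom i
    ; act     = _∘_
    ; act-id  = idˡ
    ; act-∘   = λ f g h → sym (assoc h f g)
    }

  infixr 5 _⊎ᴹ_
  _⊎ᴹ_ : Model J → Model J → Model J
  M ⊎ᴹ N = record
    { carrier = λ k → carrier M k ⊎ carrier N k
    ; act     = act-⊎
    ; act-id  = act-⊎-id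
    ; act-∘   = act-⊎-∘
    }
    where
      act-⊎ : {k l : Obj} → Hom k l → carrier M k ⊎ carrier N k → carrier M l ⊎ carrier N l
      act-⊎ f (inj₁ a) = inj₁ (act M f a)
      act-⊎ f (inj₂ b) = inj₂ (act N f b)

      act-⊎-id : {k : Obj} (v : carrier M k ⊎ carrier N k) → act-⊎ (id k) v ≡ v
      act-⊎-id (inj₁ a) = cong inj₁ (act-id M a)
      act-⊎-id (inj₂ b) = cong inj₂ (act-id N b)

      act-⊎-∘ : {k l m : Obj} (f : Hom k l) (g : Hom l m) (v : carrier M k ⊎ carrier N k) →
                act-⊎ g (act-⊎ f v) ≡ act-⊎ (g ∘ f) v
      act-⊎-∘ f g (inj₁ a) = cong inj₁ (act-∘ M f g a)
      act-⊎-∘ f g (inj₂ b) = cong inj₂ (act-∘ N f g b)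

  infix 4 _⇒_
  record _⇒_ (M N : Model J) : Set where
    field
      map     : {k : Obj} → carrier M k → carrier N k
      map-act : {k l : Obj} (f : Hom k l) (a : carrier M k) →
                map (act M f a) ≡ act N f (map a)

  inj₁ᴹ : (M N : Model J) → M ⇒ M ⊎ᴹ N
  inj₁ᴹ M N = record { map = inj₁ ; map-act = λ _ _ → refl }

module Soundness {J : Category} {M N : Model J} {i : Category.Obj J}
                 (h : M ⇒ N) (ξ : Model.carrier N i) where
  open Category J
  open Model N
  open Theory J M i
  open _⇒_ h

  ⟦_⟧ : {k : Obj} → Term k → carrier k
  ⟦ const a ⟧ = map a
  ⟦ x ⟧       = ξ
  ⟦ app f t ⟧ = act f ⟦ t ⟧

  ≐-sound : {k : Obj} {t s : Term k} → ⊢ t ≐ s → ⟦ t ⟧ ≡ ⟦ s ⟧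
  ≐-sound (ax-id {t = t} _)   = act-id ⟦ t ⟧
  ≐-sound (ax-∘ f g {t} _)    = act-∘ f g ⟦ t ⟧
  ≐-sound (ax-diag f a)       = map-act f a
  ≐-sound (refl≐ _)           = refl
  ≐-sound (sym≐ t≐s)          = sym (≐-sound t≐s)
  ≐-sound (trans≐ t≐s s≐u)    = trans (≐-sound t≐s) (≐-sound s≐u)
  ≐-sound (cong≐ f t≐s _)     = cong (act f) (≐-sound t≐s)

lemma20 : (J : Category) (M : Model J) {i j : Category.Obj J}
          (f f′ : Category.Hom J i j) →
          Theory.⊢_≐_ J M i (Theory.app f (Theory.x)) (Theory.app f′ (Theory.x)) →
          f ≡ f′
lemma20 J M {i} f f′ fx≐f′x = begin
  f            ≡⟨ sym (idʳ f) ⟩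
  f ∘ id i     ≡⟨ inj₂-injective (≐-sound fx≐f′x) ⟩
  f′ ∘ id i    ≡⟨ idʳ f′ ⟩
  f′           ∎
  where
    open Category J
    open ≡-Reasoning
    open Soundness (inj₁ᴹ M (representable i)) (inj₂ (id i))
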